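{- Let $P=(V,\leq)$ be a finite ordered set and let $x,y,z\in V$ be three distinct elements such that $x<z$ and $y$ is incomparable to both $x$ and $z$. Suppose that $(y,z)$ is a critical pair of $P$, and let $Q=P\vee(y,z)$. Then $$\mathbb{P}_Q(x<y)<\mathbb{P}_P(x<y)\leq\frac{2\,\mathbb{P}_Q(x<y)}{1+\mathbb{P}_Q(x<y)}.$$
   Context: For $u\in V$, $D(u)=\{v: v<u\}$, $U(u)=\{v: u<v\}$. An incomparable pair $(a,b)$ is critical if $U(b)\subseteq U(a)$ and $D(a)\subseteq D(b)$. For $(a,b)$ with $b\not< a$, $P\vee(a,b)$ is the order $P\cup\{(u,v): u\leq a \text{ and } b\leq v \text{ in } P\}$ (transitive closure of $P$ with $a<b$ added). For an ordered set $R$, $\mathbb{P}_R(x<y)$ is the proportion of linear extensions of $R$ that put $x$ before $y$. -}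

module Defs where

open import Data.Nat as ℕ using (ℕ; zero; suc)
open import Data.Fin using (Fin; toℕ)
open import Data.Fin.Properties using (all?; _≟_)
open import Data.Vec using (Vec; []; _∷_; lookup)
open import Data.List using (List; []; _∷_; concatMap; map; length; filter)
open import Data.Product using (_×_; _,_; Σ)
open import Data.Sum using (_⊎_; inj₁; inj₂)
open import Data.Integer using (+_)
open import Data.Rational as ℚ using (ℚ; 0ℚ)
import Data.Rational.Properties as ℚP
open import Relation.Nullary using (¬_; Dec; yes; no)
open import Relation.Nullary.Decidable using (_×-dec_; _→-dec_; _⊎-dec_; ¬?)
open import Relation.Binary using (Rel; Decidable; IsPartialOrder)
open import Relation.Binary.PropositionalEquality using (_≡_; _≢_)

record FinPoset (n : ℕ) : Set₁ where
  field
    _≤_ : Rel (Fin n) _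
    isPartialOrder : IsPartialOrder _≡_ _≤_
    _≤?_ : Decidable _≤_

module _ {n : ℕ} (P : FinPoset n) where
  open FinPoset P

  Lt : Fin n → Fin n → Set
  Lt u v = u ≤ v × u ≢ v

  Incomparable : Fin n → Fin n → Set
  Incomparable a b = ¬ (a ≤ b) × ¬ (b ≤ a)

  Critical : Fin n → Fin n → Set
  Critical a b = Incomparable a b
               × (∀ v → Lt b v → Lt a v)
               × (∀ v → Lt v a → Lt v b)

  -- linear extensions encoded as position maps π : V → Fin n (a vector),
  -- which are injective (hence bijective) and order preserving
  IsLinExt : Vec (Fin n) n → Set
  IsLinExt π = (∀ i j → lookup π i ≡ lookup π j → i ≡ j)
             × (∀ u v → u ≤ v → toℕ (lookup π u) ℕ.≤ toℕ (lookup π v))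

  isLinExt? : ∀ π → Dec (IsLinExt π)
  isLinExt? π = all? (λ i → all? (λ j → (lookup π i ≟ lookup π j) →-dec (i ≟ j)))
           ×-dec all? (λ u → all? (λ v → (u ≤? v) →-dec (toℕ (lookup π u) ℕ.≤? toℕ (lookup π v))))

allVecs : (n m : ℕ) → List (Vec (Fin n) m)
allVecs n zero = [] ∷ []
allVecs n (suc m) = concatMap (λ vs → map (_∷ vs) (Data.List.allFin n)) (allVecs n m)
  where import Data.List

linExts : ∀ {n} → FinPoset n → List (Vec (Fin n) n)
linExts {n} P = filter (isLinExt? P) (allVecs n n)

countBefore : ∀ {n} → FinPoset n → Fin n → Fin n → ℕ
countBefore P x y =
  length (filter (λ π → toℕ (lookup π x) ℕ.<? toℕ (lookup π y)) (linExts P))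

-- ℙ_R(x<y) as a rational (the number of linear extensions is always ≥ 1;
-- the zero case is a dead branch)
prob : ∀ {n} → FinPoset n → Fin n → Fin n → ℚ
prob P x y with length (linExts P)
... | zero = 0ℚ
... | suc k = (+ countBefore P x y) ℚ./ suc k

-- division of rationals (used only with nonzero denominators)
_÷_ : ℚ → ℚ → ℚ
p ÷ q with q ℚP.≟ 0ℚ
... | yes _ = 0ℚ
... | no q≢0 = ℚ._÷_ p q {{ℚ.≢-nonZero q≢0}}

join : ∀ {n} (P : FinPoset n) (a b : Fin n) → ¬ FinPoset._≤_ P b a → FinPoset n
join {n} P a b b≰a = record
  { _≤_ = Q
  ; isPartialOrder = po
  ; _≤?_ = λ u v → (u ≤? v) ⊎-dec ((u ≤? a) ×-dec (b ≤? v))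
  }
  where
  open FinPoset P
  open IsPartialOrder isPartialOrder
  Q : Rel (Fin n) _
  Q u v = u ≤ v ⊎ (u ≤ a × b ≤ v)
  po : IsPartialOrder _≡_ Q
  po = record
    { isPreorder = record
      { isEquivalence = Relation.Binary.PropositionalEquality.isEquivalence
      ; reflexive = λ e → inj₁ (reflexive e)
      ; trans = tr }
    ; antisym = as }
    where
    tr : ∀ {i j k} → Q i j → Q j k → Q i k
    tr (inj₁ p) (inj₁ q) = inj₁ (trans p q)
    tr (inj₁ p) (inj₂ (q , r)) = inj₂ (trans p q , r)
    tr (inj₂ (p , q)) (inj₁ r) = inj₂ (p , trans q r)
    tr (inj₂ (p , q)) (inj₂ (r , s)) = Data.Empty.⊥-elim (b≰a (trans q r))
      where import Data.Empty
    as : ∀ {i j} → Q i j → Q j i → i ≡ j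
    as (inj₁ p) (inj₁ q) = antisym p q
    as (inj₁ p) (inj₂ (q , r)) = Data.Empty.⊥-elim (b≰a (trans r (trans p q)))
      where import Data.Empty
    as (inj₂ (p , q)) (inj₁ r) = Data.Empty.⊥-elim (b≰a (trans q (trans r p)))
      where import Data.Empty
    as (inj₂ (p , q)) (inj₂ (r , s)) = Data.Empty.⊥-elim (b≰a (trans q r))
      where import Data.Empty

module Submission where

-- Write e(S) for the number of linear extensions of S.  Since y ∥ z, every linear
-- extension of P extends exactly one of Q = P ∨ (y,z) and R = P ∨ (z,y).  With
-- N = e(Q), a = #{Q-extensions with x before y} and b = e(R), we get ℙ_Q(x<y) = a/N
-- and, as every R-extension reads x < z < y, ℙ_P(x<y) = (a+b)/(N+b).  Swapping y and z
-- turns an R-extension into a Q-extension with x before y (this is where criticality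
-- enters), so b ≤ a; moreover 0 < b and a < N.  Hence a/N < (a+b)/(N+b) ≤ 2a/(N+a),
-- the last step being (a-b)(N-a) ≥ 0.

open import Defs
open import Data.Nat using (ℕ)
open import Data.Fin using (Fin)
open import Data.Product using (_×_; proj₁; proj₂)
open import Relation.Binary.PropositionalEquality using (_≢_)

module Counting where

  open import Level using (Level)
  open import Data.Nat using (ℕ; suc; _+_; _≤_; _<_; z≤n; s≤s)
  open import Data.Nat.Properties using (+-suc; m≤n⇒m≤1+n)
  open import Data.List using (List; []; _∷_; length; filter; map; _++_)
  open import Data.List.Properties using (length-map; length-++-sucʳ)
  open import Data.List.Membership.Propositional using (_∈_)
  open import Data.List.Membership.Propositional.Properties
    using (∈-∃++; ∈-++⁻; ∈-++⁺ˡ; ∈-++⁺ʳ; ∈-map⁻; ∈-filter⁺; ∈-filter⁻)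
  open import Data.List.Relation.Unary.Any using (here; there)
  open import Data.List.Relation.Unary.All as All using ()
  open import Data.List.Relation.Unary.AllPairs using (_∷_)
  open import Data.List.Relation.Unary.Unique.Propositional using (Unique)
  import Data.List.Relation.Unary.Unique.Propositional.Properties as Unique
  open import Data.Product using (_,_; proj₂)
  open import Data.Sum using (inj₁; inj₂; [_,_])
  open import Data.Empty using (⊥-elim)
  open import Function.Definitions using (Injective)
  open import Relation.Nullary using (¬_; yes; no)
  open import Relation.Unary using (Pred; Decidable; _⊆_; _≐_; _∪_; _∩_; Empty)
  open import Relation.Unary.Properties using (_∩?_)
  open import Relation.Binary.PropositionalEquality using (_≡_; refl; sym; trans; cong; cong₂; subst; module ≡-Reasoning)

  module _ {a} {A : Set a} where

    private
      variable
        p q r s : Level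
        P : Pred A p
        Q : Pred A q
        R : Pred A r
        S : Pred A s

    count : Decidable P → List A → ℕ
    count P? xs = length (filter P? xs)

    count-partition : (P? : Decidable P) (Q? : Decidable Q) (R? : Decidable R) →
                      P ≐ Q ∪ R → Empty (Q ∩ R) →
                      ∀ xs → count P? xs ≡ count Q? xs + count R? xs
    count-partition P? Q? R? P≐Q∪R Q∩R=∅ [] = refl
    count-partition P? Q? R? P≐Q∪R@(P⊆Q∪R , Q∪R⊆P) Q∩R=∅ (x ∷ xs)
      with ih ← count-partition P? Q? R? P≐Q∪R Q∩R=∅ xs | P? x | Q? x | R? x
    ... | yes _  | yes qx | yes rx = ⊥-elim (Q∩R=∅ x (qx , rx))
    ... | yes _  | yes _  | no _   = cong suc ih
    ... | yes _  | no _   | yes _  = trans (cong suc ih) (sym (+-suc _ _))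
    ... | yes px | no ¬qx | no ¬rx = ⊥-elim ([ ¬qx , ¬rx ] (P⊆Q∪R px))
    ... | no ¬px | yes qx | _      = ⊥-elim (¬px (Q∪R⊆P (inj₁ qx)))
    ... | no ¬px | no _   | yes rx = ⊥-elim (¬px (Q∪R⊆P (inj₂ rx)))
    ... | no _   | no _   | no _   = ih

    count-filter : (P? : Decidable P) (S? : Decidable S) →
                   ∀ xs → count S? (filter P? xs) ≡ count (P? ∩? S?) xs
    count-filter P? S? [] = refl
    count-filter P? S? (x ∷ xs) with ih ← count-filter P? S? xs | P? x
    ... | no _ = ih
    ... | yes _ with S? x
    ...   | yes _ = cong suc ih
    ...   | no _  = ih

    count-filter-partition : (P? : Decidable P) (Q? : Decidable Q) (R? : Decidable R) →
                             P ≐ Q ∪ R → Empty (Q ∩ R) → (S? : Decidable S) →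
                             ∀ xs → count S? (filter P? xs) ≡ count S? (filter Q? xs) + count S? (filter R? xs)
    count-filter-partition {P = P} {Q = Q} {R = R} {S = S} P? Q? R? (P⊆Q∪R , Q∪R⊆P) Q∩R=∅ S? xs = begin
      count S? (filter P? xs)                           ≡⟨ count-filter P? S? xs ⟩
      count (P? ∩? S?) xs                               ≡⟨ count-partition (P? ∩? S?) (Q? ∩? S?) (R? ∩? S?)
                                                             (P∩S⊆ , ⊆P∩S) Q∩S∩R∩S=∅ xs ⟩
      count (Q? ∩? S?) xs + count (R? ∩? S?) xs         ≡⟨ cong₂ _+_ (count-filter Q? S? xs) (count-filter R? S? xs) ⟨
      count S? (filter Q? xs) + count S? (filter R? xs) ∎
      where
      open ≡-Reasoning
      P∩S⊆ : P ∩ S ⊆ (Q ∩ S) ∪ (R ∩ S)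
      P∩S⊆ (px , sx) = [ (λ qx → inj₁ (qx , sx)) , (λ rx → inj₂ (rx , sx)) ] (P⊆Q∪R px)
      ⊆P∩S : (Q ∩ S) ∪ (R ∩ S) ⊆ P ∩ S
      ⊆P∩S (inj₁ (qx , sx)) = Q∪R⊆P (inj₁ qx) , sx
      ⊆P∩S (inj₂ (rx , sx)) = Q∪R⊆P (inj₂ rx) , sx
      Q∩S∩R∩S=∅ : Empty ((Q ∩ S) ∩ (R ∩ S))
      Q∩S∩R∩S=∅ x ((qx , _) , (rx , _)) = Q∩R=∅ x (qx , rx)

    count-mono : (P? : Decidable P) (Q? : Decidable Q) → P ⊆ Q → ∀ xs → count P? xs ≤ count Q? xs
    count-mono P? Q? P⊆Q [] = z≤n
    count-mono P? Q? P⊆Q (x ∷ xs) with ih ← count-mono P? Q? P⊆Q xs | P? x | Q? x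
    ... | yes _  | yes _  = s≤s ih
    ... | yes px | no ¬qx = ⊥-elim (¬qx (P⊆Q px))
    ... | no _   | yes _  = m≤n⇒m≤1+n ih
    ... | no _   | no _   = ih

    count-mono-< : (P? : Decidable P) (Q? : Decidable Q) → P ⊆ Q →
                   ∀ {x xs} → x ∈ xs → Q x → ¬ P x → count P? xs < count Q? xs
    count-mono-< P? Q? P⊆Q {xs = x ∷ xs} (here refl) qx ¬px with P? x | Q? x
    ... | yes px | _      = ⊥-elim (¬px px)
    ... | no _   | yes _  = s≤s (count-mono P? Q? P⊆Q xs)
    ... | no _   | no ¬qx = ⊥-elim (¬qx qx)
    count-mono-< P? Q? P⊆Q {xs = w ∷ xs} (there x∈xs) qx ¬px
      with ih ← count-mono-< P? Q? P⊆Q x∈xs qx ¬px | P? w | Q? w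
    ... | yes _  | yes _  = s≤s ih
    ... | yes pw | no ¬qw = ⊥-elim (¬qw (P⊆Q pw))
    ... | no _   | yes _  = m≤n⇒m≤1+n ih
    ... | no _   | no _   = ih

    unique-⊆⇒length-≤ : {xs ys : List A} → Unique xs → (∀ {v} → v ∈ xs → v ∈ ys) → length xs ≤ length ys
    unique-⊆⇒length-≤ {xs = []} _ _ = z≤n
    unique-⊆⇒length-≤ {xs = x ∷ xs} (x∉xs ∷ unique) xs⊆ys with ∈-∃++ (xs⊆ys (here refl))
    ... | ys₁ , ys₂ , refl = subst (suc (length xs) ≤_) (sym (length-++-sucʳ ys₁ x ys₂))
                                   (s≤s (unique-⊆⇒length-≤ unique xs⊆ys₁++ys₂))
      where
      xs⊆ys₁++ys₂ : ∀ {v} → v ∈ xs → v ∈ ys₁ ++ ys₂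
      xs⊆ys₁++ys₂ v∈xs with ∈-++⁻ ys₁ (xs⊆ys (there v∈xs))
      ... | inj₁ v∈ys₁        = ∈-++⁺ˡ v∈ys₁
      ... | inj₂ (here refl)  = ⊥-elim (All.lookup x∉xs v∈xs refl)
      ... | inj₂ (there v∈ys₂) = ∈-++⁺ʳ ys₁ v∈ys₂

    count-injection : (P? : Decidable P) (Q? : Decidable Q) {f : A → A} → Injective _≡_ _≡_ f →
                      (∀ {x} → P x → Q (f x)) → ∀ {xs} → Unique xs → (∀ x → x ∈ xs) →
                      count P? xs ≤ count Q? xs
    count-injection P? Q? {f} f-inj P⇒Q∘f {xs} unique complete =
      subst (_≤ count Q? xs) (length-map f (filter P? xs))
        (unique-⊆⇒length-≤ (Unique.map⁺ f-inj (Unique.filter⁺ P? unique)) image⊆)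
      where
      image⊆ : ∀ {v} → v ∈ map f (filter P? xs) → v ∈ filter Q? xs
      image⊆ v∈ with ∈-map⁻ f v∈
      ... | x , x∈ , refl = ∈-filter⁺ Q? (complete (f x)) (P⇒Q∘f (proj₂ (∈-filter⁻ P? {xs = xs} x∈)))

module CrossMultiplication where

  open import Data.Nat using (NonZero; _+_; _*_; _≤_; _<_)
  open import Data.Nat.Properties
  open import Data.Nat.Tactic.RingSolver using (solve-∀)
  open import Data.Product using (_,_)
  open import Relation.Binary.PropositionalEquality using (_≡_; refl; sym; cong)

  mediant-cross-< : ∀ {a n} b .{{_ : NonZero b}} → a < n → a * (n + b) < (a + b) * n
  mediant-cross-< {a} {n} b a<n = begin-strict
    a * (n + b)    ≡⟨ *-distribˡ-+ a n b ⟩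
    a * n + a * b  <⟨ +-monoʳ-< (a * n) (*-monoˡ-< b a<n) ⟩
    a * n + n * b  ≡⟨ cong (a * n +_) (*-comm n b) ⟩
    a * n + b * n  ≡⟨ *-distribʳ-+ n a b ⟨
    (a + b) * n    ∎
    where open ≤-Reasoning

  -- 2a(n+b) - (a+b)(n+a) = (a-b)(n-a)
  mediant-cross-≤ : ∀ {a b n} → b ≤ a → a ≤ n → (a + b) * (n + a) ≤ 2 * a * (n + b)
  mediant-cross-≤ {b = b} b≤a a≤n with m≤n⇒∃[o]m+o≡n b≤a | m≤n⇒∃[o]m+o≡n a≤n
  ... | f , refl | e , refl = ≤-trans (m≤m+n _ (f * e)) (≤-reflexive (sym (expand b f e)))
    where
    expand : ∀ b f e → 2 * (b + f) * (b + f + e + b) ≡ (b + f + b) * (b + f + e + (b + f)) + f * e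
    expand = solve-∀

module Probabilities where

  open import Data.Nat as ℕ using (ℕ; suc; s≤s)
  import Data.Nat.Properties as ℕ
  open import Data.List using (length)
  open import Data.Integer as ℤ using (+_; +≤+; +<+)
  import Data.Integer.Properties as ℤ
  open import Data.Rational using (ℚ; 1ℚ; 0ℚ; _+_; _*_; _<_; _≤_; _/_; 1/_; toℚᵘ; NonZero; Positive; NonNegative; ≢-nonZero)
  open import Data.Rational.Properties
  open import Data.Rational.Unnormalised as ℚᵘ using (mkℚᵘ; *≤*; *<*)
  import Data.Rational.Unnormalised.Properties as ℚᵘ
  open import Data.Product using (_×_; _,_)
  open import Relation.Nullary using (yes; no; contradiction)
  open import Relation.Binary.PropositionalEquality using (_≡_; refl; sym; trans; cong; cong₂; subst₂)
  open CrossMultiplication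

  toℚᵘ-/ : ∀ i d → toℚᵘ (i / suc d) ℚᵘ.≃ mkℚᵘ i d
  toℚᵘ-/ i d = toℚᵘ-fromℚᵘ (mkℚᵘ i d)

  /-+-/ : ∀ m c n d → (+ m / suc c) + (+ n / suc d) ≡ + (m ℕ.* suc d ℕ.+ n ℕ.* suc c) / (suc c ℕ.* suc d)
  /-+-/ m c n d = toℚᵘ-injective (ℚᵘ.≃-trans (toℚᵘ-homo-+ (+ m / suc c) (+ n / suc d))
    (ℚᵘ.≃-trans (ℚᵘ.+-cong (toℚᵘ-/ (+ m) c) (toℚᵘ-/ (+ n) d))
    (ℚᵘ.≃-trans (ℚᵘ.≃-reflexive (cong (λ i → mkℚᵘ i _) numerator)) (ℚᵘ.≃-sym (toℚᵘ-/ _ _)))))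
    where
    numerator : + m ℤ.* + suc d ℤ.+ + n ℤ.* + suc c ≡ + (m ℕ.* suc d ℕ.+ n ℕ.* suc c)
    numerator = sym (trans (ℤ.pos-+ (m ℕ.* suc d) _) (cong₂ ℤ._+_ (ℤ.pos-* m (suc d)) (ℤ.pos-* n (suc c))))

  /-*-/ : ∀ m c n d → (+ m / suc c) * (+ n / suc d) ≡ + (m ℕ.* n) / (suc c ℕ.* suc d)
  /-*-/ m c n d = toℚᵘ-injective (ℚᵘ.≃-trans (toℚᵘ-homo-* (+ m / suc c) (+ n / suc d))
    (ℚᵘ.≃-trans (ℚᵘ.*-cong (toℚᵘ-/ (+ m) c) (toℚᵘ-/ (+ n) d))
    (ℚᵘ.≃-trans (ℚᵘ.≃-reflexive (cong (λ i → mkℚᵘ i _) (sym (ℤ.pos-* m n)))) (ℚᵘ.≃-sym (toℚᵘ-/ _ _)))))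

  /-≤-/ : ∀ m c n d → m ℕ.* suc d ℕ.≤ n ℕ.* suc c → + m / suc c ≤ + n / suc d
  /-≤-/ m c n d le = toℚᵘ-cancel-≤
    (ℚᵘ.≤-respˡ-≃ (ℚᵘ.≃-sym (toℚᵘ-/ (+ m) c)) (ℚᵘ.≤-respʳ-≃ (ℚᵘ.≃-sym (toℚᵘ-/ (+ n) d))
      (*≤* (subst₂ ℤ._≤_ (ℤ.pos-* m (suc d)) (ℤ.pos-* n (suc c)) (+≤+ le)))))

  /-<-/ : ∀ m c n d → m ℕ.* suc d ℕ.< n ℕ.* suc c → + m / suc c < + n / suc d
  /-<-/ m c n d lt = toℚᵘ-cancel-<
    (ℚᵘ.<-respˡ-≃ (ℚᵘ.≃-sym (toℚᵘ-/ (+ m) c)) (ℚᵘ.<-respʳ-≃ (ℚᵘ.≃-sym (toℚᵘ-/ (+ n) d))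
      (*<* (subst₂ ℤ._<_ (ℤ.pos-* m (suc d)) (ℤ.pos-* n (suc c)) (+<+ lt)))))

  ≤-÷ : ∀ {q t} s .{{_ : Positive s}} → q * s ≤ t → q ≤ t ÷ s
  ≤-÷ {q} {t} s qs≤t with s ≟ 0ℚ
  ... | yes s≡0 = contradiction (sym s≡0) (<⇒≢ (positive⁻¹ s))
  ... | no s≢0 = *-cancelʳ-≤-pos s (begin
    q * s          ≤⟨ qs≤t ⟩
    t              ≡⟨ *-identityʳ t ⟨
    t * 1ℚ         ≡⟨ cong (t *_) (*-inverseˡ s) ⟨
    t * (1/s * s)  ≡⟨ *-assoc t 1/s s ⟨
    t * 1/s * s    ∎)
    where
    open ≤-Reasoning
    instance
      s≢0ℚ : NonZero s
      s≢0ℚ = ≢-nonZero s≢0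
    1/s : ℚ
    1/s = 1/ s

  Bounds : ℚ → ℚ → Set
  Bounds p q = (p < q) × (q ≤ ((1ℚ + 1ℚ) * p) ÷ (1ℚ + p))

  mediant-< : ∀ {a k b} → a ℕ.≤ k → 0 ℕ.< b → + a / suc k < + (a ℕ.+ b) / suc (k ℕ.+ b)
  mediant-< {a} {k} {b} a≤k (s≤s _) = /-<-/ a k (a ℕ.+ b) (k ℕ.+ b) (mediant-cross-< b (s≤s a≤k))

  mediant-≤ : ∀ {a k b} → b ℕ.≤ a → a ℕ.≤ k →
              + (a ℕ.+ b) / suc (k ℕ.+ b) ≤ ((1ℚ + 1ℚ) * (+ a / suc k)) ÷ (1ℚ + + a / suc k)
  mediant-≤ {a} {k} {b} b≤a a≤k = ≤-÷ (1ℚ + p) (begin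
    q * (1ℚ + p)                                   ≡⟨ cong (q *_) 1+p≡ ⟩
    q * (+ (n ℕ.+ a) / n)                          ≡⟨ /-*-/ (a ℕ.+ b) (k ℕ.+ b) (n ℕ.+ a) k ⟩
    + ((a ℕ.+ b) ℕ.* (n ℕ.+ a)) / suc d            ≤⟨ /-≤-/ ((a ℕ.+ b) ℕ.* (n ℕ.+ a)) d (2 ℕ.* a) k cross ⟩
    + (2 ℕ.* a) / n                                ≡⟨ 2p≡ ⟨
    (1ℚ + 1ℚ) * p                                  ∎)
    where
    open ≤-Reasoning
    n d : ℕ
    n = suc k
    -- suc d reduces to (n + b) * n
    d = k ℕ.+ (k ℕ.+ b) ℕ.* n
    p q : ℚ
    p = + a / n
    q = + (a ℕ.+ b) / suc (k ℕ.+ b)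
    instance
      p≥0 : NonNegative p
      p≥0 = normalize-nonNeg a n
      1+p>0 : Positive (1ℚ + p)
      1+p>0 = pos+nonNeg⇒pos 1ℚ p
    1+p≡ : 1ℚ + p ≡ + (n ℕ.+ a) / n
    1+p≡ = trans (/-+-/ 1 0 a k)
      (/-cong {q₂ = n} (cong +_ (cong₂ ℕ._+_ (ℕ.*-identityˡ n) (ℕ.*-identityʳ a))) (ℕ.*-identityˡ n))
    2p≡ : (1ℚ + 1ℚ) * p ≡ + (2 ℕ.* a) / n
    2p≡ = trans (/-*-/ 2 0 a k) (/-cong {p₂ = + (2 ℕ.* a)} {q₂ = n} refl (ℕ.*-identityˡ n))
    cross : (a ℕ.+ b) ℕ.* (n ℕ.+ a) ℕ.* n ℕ.≤ 2 ℕ.* a ℕ.* ((n ℕ.+ b) ℕ.* n)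
    cross = ℕ.≤-trans (ℕ.*-monoˡ-≤ n (mediant-cross-≤ b≤a (ℕ.m≤n⇒m≤1+n a≤k)))
                      (ℕ.≤-reflexive (ℕ.*-assoc (2 ℕ.* a) (n ℕ.+ b) n))

  prob-fraction : ∀ {m} (R : FinPoset m) x y {k} → length (linExts R) ≡ suc k →
                  prob R x y ≡ + countBefore R x y / suc k
  prob-fraction R x y eq with length (linExts R) | eq
  ... | _ | refl = refl

  prob-bounds : ∀ {m} (P Q : FinPoset m) (x y : Fin m) {b} →
                length (linExts P) ≡ length (linExts Q) ℕ.+ b →
                countBefore P x y ≡ countBefore Q x y ℕ.+ b →
                0 ℕ.< b → b ℕ.≤ countBefore Q x y → countBefore Q x y ℕ.< length (linExts Q) →
                Bounds (prob Q x y) (prob P x y)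
  prob-bounds P Q x y {b} NP≡NQ+b cP≡cQ+b 0<b b≤cQ cQ<NQ = go (length (linExts Q)) refl cQ<NQ
    where
    go : ∀ N → length (linExts Q) ≡ N → countBefore Q x y ℕ.< N → Bounds (prob Q x y) (prob P x y)
    go (suc k) NQ≡ (s≤s cQ≤k) = subst₂ Bounds (sym (prob-fraction Q x y NQ≡)) (sym probP≡)
                                  (mediant-< cQ≤k 0<b , mediant-≤ b≤cQ cQ≤k)
      where
      probP≡ : prob P x y ≡ + (countBefore Q x y ℕ.+ b) / suc (k ℕ.+ b)
      probP≡ = trans (prob-fraction P x y (trans NP≡NQ+b (cong (ℕ._+ b) NQ≡)))
                     (/-cong {q₂ = suc (k ℕ.+ b)} (cong +_ cP≡cQ+b) refl)

module LinearExtensions where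

  open import Data.Nat using (ℕ; zero; suc; _<_; _<?_)
  import Data.Nat as ℕ
  import Data.Nat.Properties as ℕ
  open import Data.Fin using (Fin; toℕ; fromℕ<)
  open import Data.Fin.Properties using (toℕ-injective; toℕ-fromℕ<; _≟_)
  open import Data.Vec using (Vec; []; _∷_; lookup; tabulate)
  open import Data.Vec.Properties using (lookup∘tabulate; tabulate∘lookup; tabulate-cong; ∷-injective)
  open import Data.List using ([]; _∷_; length; allFin; concatMap; map; _++_; cartesianProductWith)
  open import Data.List.Properties using (length-tabulate; filter-notAll)
  open import Data.List.Membership.Propositional using (_∈_)
  open import Data.List.Membership.Propositional.Properties using (∈-allFin; ∈-cartesianProductWith⁺)
  open import Data.List.Relation.Unary.Any as Any using (here)
  open import Data.List.Relation.Unary.All using ([])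
  open import Data.List.Relation.Unary.AllPairs using ([]; _∷_)
  open import Data.List.Relation.Unary.Unique.Propositional using (Unique)
  import Data.List.Relation.Unary.Unique.Propositional.Properties as Unique
  open import Data.Product using (Σ; _×_; _,_; proj₁; proj₂; swap)
  open import Data.Product.Relation.Binary.Lex.Strict using (×-isStrictTotalOrder)
  open import Data.Sum using (_⊎_; inj₁; inj₂; [_,_])
  open import Function using (_∘_)
  open import Function.Definitions using (Injective)
  open import Relation.Nullary using (Dec; ¬_; yes; no; contradiction)
  open import Relation.Nullary.Decidable using (_×-dec_; ¬?)
  open import Relation.Unary using (_≐_; _∪_; _∩_; Empty)
  open import Relation.Binary using (Rel; IsPartialOrder; IsStrictTotalOrder; tri<; tri≈; tri>)
  import Relation.Binary.Construct.On as On
  open import Relation.Binary.PropositionalEquality using (_≡_; _≢_; refl; sym; trans; cong; subst; subst₂; module ≡-Reasoning)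
  open Counting

  concatMap-map≡cartesianProductWith : ∀ {a b c} {A : Set a} {B : Set b} {C : Set c} (f : A → B → C) xs ys →
    concatMap (λ x → map (f x) ys) xs ≡ cartesianProductWith f xs ys
  concatMap-map≡cartesianProductWith f [] ys = refl
  concatMap-map≡cartesianProductWith f (x ∷ xs) ys = cong (map (f x) ys ++_) (concatMap-map≡cartesianProductWith f xs ys)

  allVecs-suc : ∀ n m → allVecs n (suc m) ≡ cartesianProductWith (λ v i → i ∷ v) (allVecs n m) (allFin n)
  allVecs-suc n m = concatMap-map≡cartesianProductWith (λ v i → i ∷ v) (allVecs n m) (allFin n)

  allVecs-complete : ∀ n m (v : Vec (Fin n) m) → v ∈ allVecs n m
  allVecs-complete n zero [] = here refl
  allVecs-complete n (suc m) (i ∷ v) = subst ((i ∷ v) ∈_) (sym (allVecs-suc n m))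
    (∈-cartesianProductWith⁺ (λ v i → i ∷ v) (allVecs-complete n m v) (∈-allFin i))

  allVecs-unique : ∀ n m → Unique (allVecs n m)
  allVecs-unique n zero = [] ∷ []
  allVecs-unique n (suc m) = subst Unique (sym (allVecs-suc n m))
    (Unique.cartesianProductWith⁺ (λ v i → i ∷ v) (swap ∘ ∷-injective) (allVecs-unique n m) (Unique.allFin⁺ n))

  module Rank {n ℓ₁ ℓ₂} {_≈_ : Rel (Fin n) ℓ₁} {_⊏_ : Rel (Fin n) ℓ₂}
              (sto : IsStrictTotalOrder _≈_ _⊏_) where

    open IsStrictTotalOrder sto using (compare; module Eq)
      renaming (_<?_ to _⊏?_; trans to ⊏-trans; irrefl to ⊏-irrefl)

    rank : Fin n → ℕ
    rank u = count (_⊏? u) (allFin n)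

    rank<n : ∀ u → rank u < n
    rank<n u = subst (rank u <_) (length-tabulate (λ i → i))
      (filter-notAll (_⊏? u) (allFin n) (Any.map (λ { refl → ⊏-irrefl Eq.refl }) (∈-allFin u)))

    rank-mono : ∀ {u v} → u ⊏ v → rank u < rank v
    rank-mono {u} {v} u⊏v =
      count-mono-< (_⊏? u) (_⊏? v) (λ w⊏u → ⊏-trans w⊏u u⊏v) (∈-allFin u) u⊏v (⊏-irrefl Eq.refl)

    rank-injective : ∀ {u v} → rank u ≡ rank v → u ≈ v
    rank-injective {u} {v} eq with compare u v
    ... | tri< u⊏v _ _ = contradiction eq (ℕ.<⇒≢ (rank-mono u⊏v))
    ... | tri≈ _ u≈v _ = u≈v
    ... | tri> _ _ v⊏u = contradiction (sym eq) (ℕ.<⇒≢ (rank-mono v⊏u))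

    rankVec : Vec (Fin n) n
    rankVec = tabulate (λ u → fromℕ< (rank<n u))

    toℕ-lookup-rankVec : ∀ u → toℕ (lookup rankVec u) ≡ rank u
    toℕ-lookup-rankVec u = trans (cong toℕ (lookup∘tabulate _ u)) (toℕ-fromℕ< (rank<n u))

  Precedes : ∀ {n} → Vec (Fin n) n → Fin n → Fin n → Set
  Precedes π u v = toℕ (lookup π u) < toℕ (lookup π v)

  precedes? : ∀ {n} (π : Vec (Fin n) n) u v → Dec (Precedes π u v)
  precedes? π u v = toℕ (lookup π u) <? toℕ (lookup π v)

  module _ {n} (R : FinPoset n) where

    open FinPoset R
    private module ≤ = IsPartialOrder isPartialOrder

    linExt-precedes : ∀ {π u v} → IsLinExt R π → u ≤ v → u ≢ v → Precedes π u v
    linExt-precedes {u = u} {v} (injective , monotone) u≤v u≢v =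
      ℕ.≤∧≢⇒< (monotone u v u≤v) (u≢v ∘ injective u v ∘ toℕ-injective)

    lt? : ∀ u v → Dec (Lt R u v)
    lt? u v = (u ≤? v) ×-dec ¬? (u ≟ v)

    height : Fin n → ℕ
    height u = count (λ w → lt? w u) (allFin n)

    height-mono : ∀ {u v} → Lt R u v → height u < height v
    height-mono {u} {v} (u≤v , u≢v) = count-mono-< (λ w → lt? w u) (λ w → lt? w v)
      (λ (w≤u , w≢u) → ≤.trans w≤u u≤v , λ { refl → w≢u (≤.antisym w≤u u≤v) })
      (∈-allFin u) (u≤v , u≢v) (λ (_ , u≢u) → u≢u refl)

    -- Rank the elements in the lexicographic order of (height, index), a strict total
    -- order refining the strict order of R.
    linExt-exists : Σ (Vec (Fin n) n) (IsLinExt R)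
    linExt-exists = rankVec , injective , monotone
      where
      key : Fin n → ℕ × ℕ
      key u = height u , toℕ u
      open Rank (On.isStrictTotalOrder key (×-isStrictTotalOrder ℕ.<-isStrictTotalOrder ℕ.<-isStrictTotalOrder))
      injective : ∀ i j → lookup rankVec i ≡ lookup rankVec j → i ≡ j
      injective i j eq = toℕ-injective (proj₂ (rank-injective
        (trans (sym (toℕ-lookup-rankVec i)) (trans (cong toℕ eq) (toℕ-lookup-rankVec j)))))
      monotone : ∀ u v → u ≤ v → toℕ (lookup rankVec u) ℕ.≤ toℕ (lookup rankVec v)
      monotone u v u≤v with u ≟ v
      ... | yes refl = ℕ.≤-refl
      ... | no u≢v = subst₂ ℕ._≤_ (sym (toℕ-lookup-rankVec u)) (sym (toℕ-lookup-rankVec v))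
                       (ℕ.<⇒≤ (rank-mono (inj₁ (height-mono (u≤v , u≢v)))))

  module _ {n} (R : FinPoset n) where

    open FinPoset R
    private module ≤ = IsPartialOrder isPartialOrder

    module _ {a b} (b≰a : ¬ b ≤ a) where

      linExt-join⁻ : ∀ {π} → IsLinExt (join R a b b≰a) π → IsLinExt R π
      linExt-join⁻ (injective , monotone) = injective , λ u v u≤v → monotone u v (inj₁ u≤v)

      linExt-join⁺ : ∀ {π} → IsLinExt R π → Precedes π a b → IsLinExt (join R a b b≰a) π
      linExt-join⁺ {π} (injective , monotone) a≺b = injective , monotone′
        where
        monotone′ : ∀ u v → FinPoset._≤_ (join R a b b≰a) u v → toℕ (lookup π u) ℕ.≤ toℕ (lookup π v)
        monotone′ u v (inj₁ u≤v)         = monotone u v u≤v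
        monotone′ u v (inj₂ (u≤a , b≤v)) =
          ℕ.≤-trans (monotone u a u≤a) (ℕ.≤-trans (ℕ.<⇒≤ a≺b) (monotone b v b≤v))

      join-precedes : a ≢ b → ∀ {π} → IsLinExt (join R a b b≰a) π → Precedes π a b
      join-precedes a≢b {π} ext = linExt-precedes (join R a b b≰a) {π} ext (inj₂ (≤.refl , ≤.refl)) a≢b

    module _ {a b} (a∥b : Incomparable R a b) where

      private
        a≰b = proj₁ a∥b
        b≰a = proj₂ a∥b
        a≢b : a ≢ b
        a≢b a≡b = a≰b (≤.reflexive a≡b)

      linExt-split : IsLinExt R ≐ IsLinExt (join R a b b≰a) ∪ IsLinExt (join R b a a≰b)
      linExt-split = (λ {π} → split {π}) , λ {π} → [ linExt-join⁻ b≰a {π} , linExt-join⁻ a≰b {π} ]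
        where
        split : ∀ {π} → IsLinExt R π → IsLinExt (join R a b b≰a) π ⊎ IsLinExt (join R b a a≰b) π
        split {π} ext with ℕ.<-cmp (toℕ (lookup π a)) (toℕ (lookup π b))
        ... | tri< a≺b _ _ = inj₁ (linExt-join⁺ b≰a {π} ext a≺b)
        ... | tri≈ _ eq _  = contradiction (proj₁ ext a b (toℕ-injective eq)) a≢b
        ... | tri> _ _ b≺a = inj₂ (linExt-join⁺ a≰b {π} ext b≺a)

      linExt-split-disjoint : Empty (IsLinExt (join R a b b≰a) ∩ IsLinExt (join R b a a≰b))
      linExt-split-disjoint π (ab , ba) =
        ℕ.<-asym (join-precedes b≰a a≢b {π} ab) (join-precedes a≰b (a≢b ∘ sym) {π} ba)

      length-linExts-split :
        length (linExts R) ≡ length (linExts (join R a b b≰a)) ℕ.+ length (linExts (join R b a a≰b))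
      length-linExts-split =
        count-partition (isLinExt? R) (isLinExt? (join R a b b≰a)) (isLinExt? (join R b a a≰b))
          linExt-split linExt-split-disjoint (allVecs n n)

      countBefore-split : ∀ x y →
        countBefore R x y ≡ countBefore (join R a b b≰a) x y ℕ.+ countBefore (join R b a a≰b) x y
      countBefore-split x y =
        count-filter-partition (isLinExt? R) (isLinExt? (join R a b b≰a)) (isLinExt? (join R b a a≰b))
          linExt-split linExt-split-disjoint (λ π → precedes? π x y) (allVecs n n)

  reindex : ∀ {n} → (Fin n → Fin n) → Vec (Fin n) n → Vec (Fin n) n
  reindex f π = tabulate (lookup π ∘ f)

  lookup-reindex : ∀ {n} (f : Fin n → Fin n) π i → lookup (reindex f π) i ≡ lookup π (f i)
  lookup-reindex f π = lookup∘tabulate (lookup π ∘ f)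

  reindex-injective : ∀ {n} {f g : Fin n → Fin n} → (∀ k → f (g k) ≡ k) → Injective _≡_ _≡_ (reindex f)
  reindex-injective {f = f} {g} f∘g≗id {π} {π′} eq =
    trans (sym (tabulate∘lookup π)) (trans (tabulate-cong pointwise) (tabulate∘lookup π′))
    where
    open ≡-Reasoning
    pointwise : ∀ k → lookup π k ≡ lookup π′ k
    pointwise k = begin
      lookup π k                  ≡⟨ cong (lookup π) (f∘g≗id k) ⟨
      lookup π (f (g k))          ≡⟨ lookup-reindex f π (g k) ⟨
      lookup (reindex f π) (g k)  ≡⟨ cong (λ σ → lookup σ (g k)) eq ⟩
      lookup (reindex f π′) (g k) ≡⟨ lookup-reindex f π′ (g k) ⟩
      lookup π′ (f (g k))         ≡⟨ cong (lookup π′) (f∘g≗id k) ⟩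
      lookup π′ k                 ∎

  linExt-reindex : ∀ {n} (S R : FinPoset n) {f g : Fin n → Fin n} → (∀ k → g (f k) ≡ k) →
                   (∀ {u v} → FinPoset._≤_ S u v → FinPoset._≤_ R (f u) (f v)) →
                   ∀ {π} → IsLinExt R π → IsLinExt S (reindex f π)
  linExt-reindex S R {f} {g} g∘f≗id f-mono {π} (injective , monotone) = injective′ , monotone′
    where
    injective′ : ∀ i j → lookup (reindex f π) i ≡ lookup (reindex f π) j → i ≡ j
    injective′ i j eq = trans (sym (g∘f≗id i)) (trans (cong g fi≡fj) (g∘f≗id j))
      where
      fi≡fj : f i ≡ f j
      fi≡fj = injective (f i) (f j) (trans (sym (lookup-reindex f π i)) (trans eq (lookup-reindex f π j)))
    monotone′ : ∀ u v → FinPoset._≤_ S u v → toℕ (lookup (reindex f π) u) ℕ.≤ toℕ (lookup (reindex f π) v)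
    monotone′ u v u≤v = subst₂ ℕ._≤_ (cong toℕ (sym (lookup-reindex f π u))) (cong toℕ (sym (lookup-reindex f π v)))
      (monotone (f u) (f v) (f-mono u≤v))

module Transposition where

  open import Data.Fin using (Fin)
  open import Data.Fin.Properties using (_≟_)
  open import Data.Fin.Permutation.Components using (transpose)
  open import Relation.Nullary.Decidable using (dec-true; dec-false)
  open import Relation.Binary.PropositionalEquality using (_≡_; _≢_; refl)

  transpose-matchˡ : ∀ {n} (i j : Fin n) → transpose i j i ≡ j
  transpose-matchˡ i j rewrite dec-true (i ≟ i) refl = refl

  transpose-other : ∀ {n} {i j k : Fin n} → k ≢ i → k ≢ j → transpose i j k ≡ k
  transpose-other {i = i} {j} {k} k≢i k≢j rewrite dec-false (k ≟ i) k≢i | dec-false (k ≟ j) k≢j = refl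

module CriticalPair {n} (P : FinPoset n) {y z : Fin n} (crit : Critical P y z) where

  open import Data.Nat as ℕ using (_<_; _≤_)
  import Data.Nat.Properties as ℕ
  open import Data.Fin using (toℕ)
  open import Data.Fin.Properties using (_≟_)
  open import Data.Fin.Permutation.Components using (transpose; transpose-inverse)
  open import Data.Vec using (Vec; lookup)
  open import Data.List using (length)
  open import Data.List.Properties using (filter-all; filter-some; filter-notAll)
  open import Data.List.Membership.Propositional.Properties using (∈-filter⁺; ∈-filter⁻)
  open import Data.List.Relation.Unary.All as All using ()
  open import Data.List.Membership.Propositional using (lose)
  open import Data.Product using (_,_)
  open import Data.Sum using (inj₁; inj₂)
  open import Data.Empty using (⊥-elim)
  open import Function using (_∘_)
  open import Relation.Nullary using (Dec; ¬_; yes; no)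
  open import Relation.Unary.Properties using (_∩?_)
  open import Relation.Binary using (IsPartialOrder)
  open import Relation.Binary.PropositionalEquality using (_≡_; refl; sym; trans; cong; subst; subst₂)
  open Counting
  open Probabilities using (Bounds; prob-bounds)
  open LinearExtensions
  open Transposition

  open FinPoset P using (isPartialOrder) renaming (_≤_ to _≤P_)
  private module ≤ = IsPartialOrder isPartialOrder

  y∥z : Incomparable P y z
  y∥z = proj₁ crit

  y≰z : ¬ y ≤P z
  y≰z = proj₁ y∥z

  z≰y : ¬ z ≤P y
  z≰y = proj₂ y∥z

  Q R : FinPoset n
  Q = join P y z z≰y
  R = join P z y y≰z

  open FinPoset Q using () renaming (_≤_ to _≤Q_)
  open FinPoset R using () renaming (_≤_ to _≤R_)

  τ : Fin n → Fin n
  τ = transpose y z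

  data Swap : Fin n → Fin n → Set where
    swapˡ : Swap y z
    swapʳ : Swap z y
    fixed : ∀ {k} → k ≢ y → k ≢ z → Swap k k

  swap-view : ∀ k → Swap k (τ k)
  swap-view k with k ≟ y
  ... | yes refl = swapˡ
  ... | no k≢y with k ≟ z
  ...   | yes refl = swapʳ
  ...   | no k≢z   = fixed k≢y k≢z

  transpose-mono : ∀ {u v} → u ≤Q v → τ u ≤R τ v
  transpose-mono {u} {v} = mono (swap-view u) (swap-view v)
    where
    up : ∀ v → Lt P z v → Lt P y v
    up = proj₁ (proj₂ crit)
    down : ∀ v → Lt P v y → Lt P v z
    down = proj₂ (proj₂ crit)
    mono : ∀ {u u′ v v′} → Swap u u′ → Swap v v′ → u ≤Q v → u′ ≤R v′
    mono swapˡ       swapˡ       _                  = inj₁ ≤.refl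
    mono swapˡ       swapʳ       _                  = inj₂ (≤.refl , ≤.refl)
    mono swapˡ       (fixed _ _) (inj₁ y≤w)         = inj₂ (≤.refl , y≤w)
    mono swapˡ       (fixed _ _) (inj₂ (_ , z≤w))   = inj₁ z≤w
    mono swapʳ       swapˡ       (inj₁ z≤y)         = ⊥-elim (z≰y z≤y)
    mono swapʳ       swapˡ       (inj₂ (z≤y , _))   = ⊥-elim (z≰y z≤y)
    mono swapʳ       swapʳ       _                  = inj₁ ≤.refl
    mono swapʳ       (fixed _ w≢z) (inj₁ z≤w)       = inj₁ (proj₁ (up _ (z≤w , w≢z ∘ sym)))
    mono swapʳ       (fixed _ _) (inj₂ (z≤y , _))   = ⊥-elim (z≰y z≤y)
    mono (fixed w≢y _) swapˡ     (inj₁ w≤y)         = inj₁ (proj₁ (down _ (w≤y , w≢y)))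
    mono (fixed _ _) swapˡ       (inj₂ (_ , z≤y))   = ⊥-elim (z≰y z≤y)
    mono (fixed _ _) swapʳ       (inj₁ w≤z)         = inj₂ (w≤z , ≤.refl)
    mono (fixed _ _) swapʳ       (inj₂ (w≤y , _))   = inj₁ w≤y
    mono (fixed _ _) (fixed _ _) (inj₁ w≤w′)        = inj₁ w≤w′
    mono (fixed w≢y _) (fixed _ _) (inj₂ (w≤y , z≤w′)) = inj₁ (≤.trans (proj₁ (down _ (w≤y , w≢y))) z≤w′)

  module _ {x} (x<z : Lt P x z) (x≰y : ¬ x ≤P y) where

    x≢y : x ≢ y
    x≢y x≡y = x≰y (≤.reflexive x≡y)

    precedes-xy? : ∀ π → Dec (Precedes π x y)
    precedes-xy? π = precedes? π x y

    linExt-R-precedes : ∀ {π} → IsLinExt R π → Precedes π x y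
    linExt-R-precedes {π} ext = linExt-precedes R {π} ext (inj₂ (proj₁ x<z , ≤.refl)) x≢y

    countBefore-R≡length : countBefore R x y ≡ length (linExts R)
    countBefore-R≡length = cong length (filter-all precedes-xy?
      (All.tabulate λ {π} π∈ → linExt-R-precedes {π} (proj₂ (∈-filter⁻ (isLinExt? R) {xs = allVecs n n} π∈))))

    transpose-precedes : ∀ {π} → IsLinExt R π → Precedes (reindex τ π) x y
    transpose-precedes {π} ext = subst₂ _<_ (cong toℕ (sym τx)) (cong toℕ (sym τy))
      (linExt-precedes R {π} ext (inj₁ (proj₁ x<z)) (proj₂ x<z))
      where
      τx : lookup (reindex τ π) x ≡ lookup π x
      τx = trans (lookup-reindex τ π x) (cong (lookup π) (transpose-other x≢y (proj₂ x<z)))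
      τy : lookup (reindex τ π) y ≡ lookup π z
      τy = trans (lookup-reindex τ π y) (cong (lookup π) (transpose-matchˡ y z))

    transpose-linExt : ∀ {π} → IsLinExt R π → IsLinExt Q (reindex τ π)
    transpose-linExt {π} = linExt-reindex Q R {g = transpose z y} (λ _ → transpose-inverse z y) transpose-mono {π}

    length-linExts-R≤countBefore-Q : length (linExts R) ≤ countBefore Q x y
    length-linExts-R≤countBefore-Q =
      subst (length (linExts R) ≤_) (sym (count-filter (isLinExt? Q) precedes-xy? (allVecs n n)))
        (count-injection (isLinExt? R) (isLinExt? Q ∩? precedes-xy?)
          (reindex-injective {g = transpose z y} (λ _ → transpose-inverse y z))
          (λ {π} ext → transpose-linExt {π} ext , transpose-precedes {π} ext)
          (allVecs-unique n n) (allVecs-complete n n))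

    length-linExts-R>0 : 0 < length (linExts R)
    length-linExts-R>0 = filter-some (isLinExt? R) (lose (allVecs-complete n n π) ext)
      where
      π : Vec (Fin n) n
      π = proj₁ (linExt-exists R)
      ext : IsLinExt R π
      ext = proj₂ (linExt-exists R)

    countBefore-Q<length-linExts-Q : countBefore Q x y < length (linExts Q)
    countBefore-Q<length-linExts-Q = filter-notAll precedes-xy? (linExts Q)
      (lose (∈-filter⁺ (isLinExt? Q) (allVecs-complete n n π) (linExt-join⁻ Q x≰Qy {π} ext))
            (ℕ.<-asym (join-precedes Q x≰Qy (x≢y ∘ sym) {π} ext)))
      where
      x≰Qy : ¬ x ≤Q y
      x≰Qy (inj₁ x≤y)      = x≰y x≤y
      x≰Qy (inj₂ (_ , z≤y)) = z≰y z≤y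
      π : Vec (Fin n) n
      π = proj₁ (linExt-exists (join Q y x x≰Qy))
      ext : IsLinExt (join Q y x x≰Qy) π
      ext = proj₂ (linExt-exists (join Q y x x≰Qy))

    bounds : Bounds (prob Q x y) (prob P x y)
    bounds = prob-bounds P Q x y (length-linExts-split P y∥z)
      (trans (countBefore-split P y∥z x y) (cong (countBefore Q x y ℕ.+_) countBefore-R≡length))
      length-linExts-R>0 length-linExts-R≤countBefore-Q countBefore-Q<length-linExts-Q

open import Data.Rational using (ℚ; 1ℚ; _+_; _*_; _<_; _≤_)

theorem4 : ∀ {n : ℕ} (P : FinPoset n) (x y z : Fin n)
    → x ≢ y → y ≢ z → x ≢ z
    → Lt P x z
    → Incomparable P y x
    → Incomparable P y z
    → (crit : Critical P y z)
    → let Q = join P y z (proj₂ (proj₁ crit))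
      in (prob Q x y < prob P x y)
         × (prob P x y ≤ ((1ℚ + 1ℚ) * prob Q x y) ÷ (1ℚ + prob Q x y))
-- The distinctness hypotheses and y ∥ z are implied by the others.
theorem4 P x y z _ _ _ x<z y∥x _ crit = CriticalPair.bounds P crit x<z (proj₂ y∥x)
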